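{- Let $G=(N,\Sigma,P,S)$ be a context-free grammar, $w=w_1\cdots w_n\in\Sigma^*$, and let $\omega_{ins},\omega_{del},\omega_{repl}$ be non-negative integer costs of inserting, deleting and replacing a symbol. Let $k$ be the minimum total cost of a sequence of insertions, deletions and replacements transforming $w$ into some word of $\mathcal{L}(G)$. Construct the edge-labeled, edge-weighted directed graph $D$ on vertices $v_1,\ldots,v_{n+1}$ with edges: a loop $v_i\to v_i$ labeled $a$ with weight $\omega_{ins}$ for every $a\in\Sigma$ and $i\in\{1,\ldots,n+1\}$; an edge $v_i\to v_{i+1}$ labeled $\epsilon$ with weight $\omega_{del}$ for every $i\in\{1,\ldots,n\}$; an edge $v_i\to v_{i+1}$ labeled $a$ with weight $\omega_{repl}$ for every $a\in\Sigma\setminus\{w_i\}$ and $i\in\{1,\ldots,n\}$; and an edge $v_i\to v_{i+1}$ labeled $w_i$ with weight $0$ for every $i\in\{1,\ldots,n\}$. Let $k'$ be the minimum weight of an $S$-path from $v_1$ to $v_{n+1}$ in $D$ with respect to $G$. Then $k=k'$.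
   Context: For a context-free grammar $G=(N,\Sigma,P,S)$, $\mathcal{L}(G)$ is the set of terminal words derivable from the start nonterminal $S$. In an edge-labeled, edge-weighted directed graph (edges labeled by symbols of $\Sigma$ or by the empty string $\epsilon$, with integer weights), a path is an $S$-path if the concatenation of the labels along it (with $\epsilon$ contributing nothing) belongs to $\mathcal{L}(G)$; paths may repeat vertices and edges. The weight of a path is the sum of the weights of its edges (with multiplicity). -}

module Defs where

open import Data.Nat using (ℕ; zero; suc; _+_; _≤_)
open import Data.Fin using (Fin; inject₁) renaming (suc to fsuc)
open import Data.List using (List; []; _∷_; _++_; [_]; map)
open import Data.List.Membership.Propositional using (_∈_)
open import Data.Vec using (Vec; lookup; toList)
open import Data.Maybe using (Maybe; just; nothing)
open import Data.Product using (_×_; _,_; ∃-syntax)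
open import Data.Sum using (_⊎_; inj₁; inj₂)
open import Relation.Binary.PropositionalEquality using (_≡_; _≢_)
open import Relation.Binary.Construct.Closure.ReflexiveTransitive using (Star)

record CFG (nN nΣ : ℕ) : Set where
  field
    P : List (Fin nN × List (Fin nN ⊎ Fin nΣ))
    S : Fin nN

module _ {nN nΣ : ℕ} (G : CFG nN nΣ) where
  open CFG G

  SententialForm : Set
  SententialForm = List (Fin nN ⊎ Fin nΣ)

  data _⇒_ : SententialForm → SententialForm → Set where
    step : ∀ α β X γ → (X , γ) ∈ P →
           (α ++ inj₁ X ∷ β) ⇒ (α ++ γ ++ β)

  InLang : List (Fin nΣ) → Set
  InLang u = Star _⇒_ [ inj₁ S ] (map inj₂ u)

module _ {nΣ : ℕ} (ωins ωdel ωrepl : ℕ) where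

  Word : Set
  Word = List (Fin nΣ)

  data EditStep : Word → Word → ℕ → Set where
    ins  : ∀ α β a → EditStep (α ++ β) (α ++ a ∷ β) ωins
    del  : ∀ α β a → EditStep (α ++ a ∷ β) (α ++ β) ωdel
    repl : ∀ α β a b → a ≢ b → EditStep (α ++ a ∷ β) (α ++ b ∷ β) ωrepl

  data EditSeq : Word → Word → ℕ → Set where
    done : ∀ u → EditSeq u u 0
    _∷ₑ_ : ∀ {u v x c c'} → EditStep u v c → EditSeq v x c' → EditSeq u x (c + c')

-- Edge-labeled, edge-weighted directed graphs (labels: Maybe Σ,
-- nothing = ε), paths and S-paths.

Graph : ℕ → ℕ → Set₁
Graph nV nΣ = Fin nV → Fin nV → Maybe (Fin nΣ) → ℕ → Set
-- E u v l c : the type of edges u → v with label l and weight c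

labelWord : ∀ {nΣ} → Maybe (Fin nΣ) → List (Fin nΣ)
labelWord nothing  = []
labelWord (just a) = [ a ]

data Path {nV nΣ} (E : Graph nV nΣ) : Fin nV → Fin nV → List (Fin nΣ) → ℕ → Set where
  [] : ∀ {u} → Path E u u [] 0
  _∷_ : ∀ {u y v l c x c'} → E u y l c → Path E y v x c' →
        Path E u v (labelWord l ++ x) (c + c')

SPath : ∀ {nN nΣ nV} → CFG nN nΣ → Graph nV nΣ → Fin nV → Fin nV → ℕ → Set
SPath G E u v c = ∃[ x ] (Path E u v x c × InLang G x)

-- The graph D built from w = w₁⋯wₙ; vertex v_i is Fin index i-1.

data DEdge {nΣ n : ℕ} (w : Vec (Fin nΣ) n) (ωins ωdel ωrepl : ℕ)
     : Graph (suc n) nΣ where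
  loopE  : ∀ (i : Fin (suc n)) (a : Fin nΣ) → DEdge w ωins ωdel ωrepl i i (just a) ωins
  delE   : ∀ (i : Fin n) → DEdge w ωins ωdel ωrepl (inject₁ i) (fsuc i) nothing ωdel
  replE  : ∀ (i : Fin n) (a : Fin nΣ) → a ≢ lookup w i →
           DEdge w ωins ωdel ωrepl (inject₁ i) (fsuc i) (just a) ωrepl
  matchE : ∀ (i : Fin n) → DEdge w ωins ωdel ωrepl (inject₁ i) (fsuc i) (just (lookup w i)) 0

IsMin : (ℕ → Set) → ℕ → Set
IsMin Q k = Q k × (∀ m → Q m → k ≤ m)

EditCost : ∀ {nN nΣ n} → CFG nN nΣ → Vec (Fin nΣ) n → ℕ → ℕ → ℕ → ℕ → Set
EditCost G w ωins ωdel ωrepl c =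
  ∃[ u ] (EditSeq ωins ωdel ωrepl (toList w) u c × InLang G u)

{-# OPTIONS --safe #-}
module Submission where

-- An edit sequence can be replayed on the labels of paths in D. Start from the
-- path of matching edges, of weight 0 and label w. An insertion of a is paid by
-- an a-loop; deleting or replacing a letter a swaps the edge reading a for a
-- deletion or replacement edge (or drops an a-loop). So each edit step turns a
-- path labelled v into one labelled v' whose weight grows by at most the cost
-- of the step. Conversely, a path from v_i to v_j labelled x is read, edge by
-- edge, as an edit sequence taking w_i⋯w_n to x w_j⋯w_n of exactly its weight.
-- Hence every cost achievable on one side is undercut on the other, and the
-- two minima coincide.

open import Algebra.Properties.CommutativeSemigroup using (xy∙z≈xz∙y)
open import Data.Nat using (ℕ; suc; _+_; _≤_; z≤n)
open import Data.Nat.Properties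
  using (≤-refl; ≤-reflexive; ≤-trans; ≤-antisym; +-assoc; +-comm; +-monoˡ-≤; +-monoʳ-≤;
         m≤m+n; m≤n+m; module ≤-Reasoning; +-commutativeSemigroup)
open import Data.Fin using (Fin; zero; fromℕ; toℕ; inject₁) renaming (suc to fsuc)
open import Data.Fin.Properties using (_≟_)
open import Data.Vec using (Vec; lookup; toList; _∷_; [])
open import Data.List using (List; []; _∷_; _++_; [_]; drop)
open import Data.List.Properties using (∷-injective; ++-identityʳ; ++-assoc)
open import Data.Maybe using (just; nothing)
open import Data.Product using (_×_; _,_; ∃-syntax)
open import Function using (_∘_)
open import Function.Bundles using (_⇔_; mk⇔)
open import Relation.Binary.PropositionalEquality
  using (_≡_; _≢_; refl; sym; trans; cong; subst; subst₂)
open import Relation.Nullary using (yes; no)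
open import Defs

+-right-comm : ∀ a b c → a + b + c ≡ a + c + b
+-right-comm = xy∙z≈xz∙y +-commutativeSemigroup

module _ {nV nΣ : ℕ} {E : Graph nV nΣ} where

  edgePath : ∀ {u v l c} → E u v l c → Path E u v (labelWord l) c
  edgePath {l = l} {c} e =
    subst₂ (Path E _ _) (++-identityʳ (labelWord l)) (+-comm c 0) (e ∷ [])

  infixr 5 _++ₚ_

  _++ₚ_ : ∀ {u y v α β c₁ c₂} → Path E u y α c₁ → Path E y v β c₂ → Path E u v (α ++ β) (c₁ + c₂)
  [] ++ₚ q = q
  _∷_ {l = l} {c = c} {x = x} {c' = c'} e p ++ₚ q =
    subst₂ (Path E _ _) (sym (++-assoc (labelWord l) x _)) (sym (+-assoc c c' _)) (e ∷ (p ++ₚ q))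

  record Split (u v : Fin nV) (α β : List (Fin nΣ)) (c : ℕ) : Set where
    constructor split
    field
      {middle} : Fin nV
      {cost₁ cost₂} : ℕ
      prefix : Path E u middle α cost₁
      suffix : Path E middle v β cost₂
      cost-≡ : c ≡ cost₁ + cost₂

  splitPath : ∀ {u v x c} α β → Path E u v x c → x ≡ α ++ β → Split u v α β c
  splitPath [] β p refl = split [] p refl
  splitPath (a ∷ α) β [] ()
  splitPath (a ∷ α) β (_∷_ {l = nothing} {c = c} e p) eq with splitPath (a ∷ α) β p eq
  ... | split p₁ p₂ refl = split (e ∷ p₁) p₂ (sym (+-assoc c _ _))
  splitPath (a ∷ α) β (_∷_ {l = just b} {c = c} e p) eq with ∷-injective eq
  ... | refl , eq′ with splitPath α β p eq′
  ... | split p₁ p₂ refl = split (e ∷ p₁) p₂ (sym (+-assoc c _ _))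

  Replaceable : List (Fin nΣ) → List (Fin nΣ) → ℕ → Set
  Replaceable δ γ d = ∀ {u v c} → Path E u v δ c → ∃[ c' ] (Path E u v γ c' × c' ≤ c + d)

  replaceable-refl : ∀ {δ} → Replaceable δ δ 0
  replaceable-refl {c = c} p = c , p , m≤m+n c 0

  replaceable-trans : ∀ {δ γ η d d'} → Replaceable δ γ d → Replaceable γ η d' → Replaceable δ η (d + d')
  replaceable-trans {d = d} {d'} r r' {c = c} p with r p
  ... | c₁ , q , c₁≤ with r' q
  ... | c₂ , q' , c₂≤ = c₂ , q' , (begin
    c₂           ≤⟨ c₂≤ ⟩
    c₁ + d'      ≤⟨ +-monoˡ-≤ d' c₁≤ ⟩
    c + d + d'   ≡⟨ +-assoc c d d' ⟩
    c + (d + d') ∎)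
    where open ≤-Reasoning

  replaceable-infix : ∀ {δ γ d} α β → Replaceable δ γ d → Replaceable (α ++ δ ++ β) (α ++ γ ++ β) d
  replaceable-infix {δ} {d = d} α β r p with splitPath α (δ ++ β) p refl
  ... | split {cost₁ = c₁} p₁ p₂ refl with splitPath δ β p₂ refl
  ... | split {cost₁ = d₁} {d₂} q₁ q₂ refl with r q₁
  ... | c' , q₁' , c'≤ = c₁ + (c' + d₂) , p₁ ++ₚ q₁' ++ₚ q₂ , (begin
    c₁ + (c' + d₂)       ≤⟨ +-monoʳ-≤ c₁ (+-monoˡ-≤ d₂ c'≤) ⟩
    c₁ + (d₁ + d + d₂)   ≡⟨ cong (c₁ +_) (+-right-comm d₁ d d₂) ⟩
    c₁ + (d₁ + d₂ + d)   ≡⟨ sym (+-assoc c₁ _ d) ⟩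
    c₁ + (d₁ + d₂) + d   ∎)
    where open ≤-Reasoning

  -- A one-letter path is one a-edge surrounded by ε-edges, so it suffices to
  -- replace the a-edge.
  replaceable-letter : ∀ {a γ d} →
    (∀ {u v c} → E u v (just a) c → ∃[ c' ] (Path E u v γ c' × c' ≤ c + d)) →
    Replaceable [ a ] γ d
  replaceable-letter {a} {γ} {d} replace p = go p refl
    where
      open ≤-Reasoning
      go : ∀ {u v x c} → Path E u v x c → x ≡ [ a ] → ∃[ c' ] (Path E u v γ c' × c' ≤ c + d)
      go [] ()
      go (_∷_ {l = nothing} {c = c} {c' = cₚ} e p) eq with go p eq
      ... | c' , q , c'≤ = c + c' , e ∷ q , (begin
        c + c'        ≤⟨ +-monoʳ-≤ c c'≤ ⟩
        c + (cₚ + d)  ≡⟨ sym (+-assoc c cₚ d) ⟩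
        c + cₚ + d    ∎)
      go (_∷_ {l = just b} {c = c} {c' = cₚ} e p) eq with ∷-injective eq
      ... | refl , refl with replace e
      ... | c' , q , c'≤ = c' + cₚ , subst (λ x → Path E _ _ x _) (++-identityʳ γ) (q ++ₚ p) , (begin
        c' + cₚ       ≤⟨ +-monoˡ-≤ cₚ c'≤ ⟩
        c + d + cₚ    ≡⟨ +-right-comm c d cₚ ⟩
        c + cₚ + d    ∎)

drop-inject₁ : ∀ {A : Set} {m} (v : Vec A m) (i : Fin m) →
  drop (toℕ (inject₁ i)) (toList v) ≡ lookup v i ∷ drop (toℕ (fsuc i)) (toList v)
drop-inject₁ (a ∷ v) zero     = refl
drop-inject₁ (a ∷ v) (fsuc i) = drop-inject₁ v i

drop-fromℕ : ∀ {A : Set} {m} (v : Vec A m) → drop (toℕ (fromℕ m)) (toList v) ≡ []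
drop-fromℕ []      = refl
drop-fromℕ (a ∷ v) = drop-fromℕ v

module EditGraph {nΣ n : ℕ} (w : Vec (Fin nΣ) n) (ωi ωd ωr : ℕ) where
  D : Graph (suc n) nΣ
  D = DEdge w ωi ωd ωr

  insert-replaceable : ∀ a → Replaceable {E = D} [] [ a ] ωi
  insert-replaceable a {u} {c = c} p = ωi + c , loopE u a ∷ p , ≤-reflexive (+-comm ωi c)

  deleteEdge : ∀ {u v a c} → D u v (just a) c → ∃[ c' ] (Path D u v [] c' × c' ≤ c + ωd)
  deleteEdge (loopE i a)   = 0 , [] , z≤n
  deleteEdge (replE i a _) = ωd , edgePath (delE i) , m≤n+m ωd ωr
  deleteEdge (matchE i)    = ωd , edgePath (delE i) , ≤-refl

  replaceEdge : ∀ {u v a b c} → a ≢ b → D u v (just a) c → ∃[ c' ] (Path D u v [ b ] c' × c' ≤ c + ωr)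
  replaceEdge {b = b} _ (loopE i a) = ωi , edgePath (loopE i b) , m≤m+n ωi ωr
  replaceEdge {b = b} _ (replE i a _) with b ≟ lookup w i
  ... | yes refl = 0 , edgePath (matchE i) , z≤n
  ... | no b≢wᵢ  = ωr , edgePath (replE i b b≢wᵢ) , m≤m+n ωr ωr
  replaceEdge wᵢ≢b (matchE i) = ωr , edgePath (replE i _ (wᵢ≢b ∘ sym)) , ≤-refl

  editStep-replaceable : ∀ {v x d} → EditStep ωi ωd ωr v x d → Replaceable {E = D} v x d
  editStep-replaceable (ins α β a)        = replaceable-infix α β (insert-replaceable a)
  editStep-replaceable (del α β a)        = replaceable-infix α β (replaceable-letter deleteEdge)
  editStep-replaceable (repl α β a b a≢b) = replaceable-infix α β (replaceable-letter (replaceEdge a≢b))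

  editSeq-replaceable : ∀ {v x d} → EditSeq ωi ωd ωr v x d → Replaceable {E = D} v x d
  editSeq-replaceable (done _)  = replaceable-refl
  editSeq-replaceable (s ∷ₑ ss) = replaceable-trans (editStep-replaceable s) (editSeq-replaceable ss)

  cons-editStep : ∀ (a : Fin nΣ) {u v c} → EditStep ωi ωd ωr u v c → EditStep ωi ωd ωr (a ∷ u) (a ∷ v) c
  cons-editStep a (ins α β b)        = ins (a ∷ α) β b
  cons-editStep a (del α β b)        = del (a ∷ α) β b
  cons-editStep a (repl α β b b' ne) = repl (a ∷ α) β b b' ne

  cons-editSeq : ∀ (a : Fin nΣ) {u v c} → EditSeq ωi ωd ωr u v c → EditSeq ωi ωd ωr (a ∷ u) (a ∷ v) c
  cons-editSeq a (done u)  = done (a ∷ u)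
  cons-editSeq a (s ∷ₑ ss) = cons-editStep a s ∷ₑ cons-editSeq a ss

  unread : Fin (suc n) → List (Fin nΣ)
  unread i = drop (toℕ i) (toList w)

  path-editSeq : ∀ {u v x c} → Path D u v x c → EditSeq ωi ωd ωr (unread u) (x ++ unread v) c
  path-editSeq [] = done _
  path-editSeq (loopE i a ∷ q) = ins [] (unread i) a ∷ₑ cons-editSeq a (path-editSeq q)
  path-editSeq (delE i ∷ q) rewrite drop-inject₁ w i =
    del [] (unread (fsuc i)) (lookup w i) ∷ₑ path-editSeq q
  path-editSeq (replE i a a≢wᵢ ∷ q) rewrite drop-inject₁ w i =
    repl [] (unread (fsuc i)) (lookup w i) a (a≢wᵢ ∘ sym) ∷ₑ cons-editSeq a (path-editSeq q)
  path-editSeq (matchE i ∷ q) rewrite drop-inject₁ w i =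
    cons-editSeq (lookup w i) (path-editSeq q)

liftEdge : ∀ {nΣ n} {w : Vec (Fin nΣ) n} {a ωi ωd ωr u v l c} →
  DEdge w ωi ωd ωr u v l c → DEdge (a ∷ w) ωi ωd ωr (fsuc u) (fsuc v) l c
liftEdge (loopE i a)     = loopE (fsuc i) a
liftEdge (delE i)        = delE (fsuc i)
liftEdge (replE i a a≢b) = replE (fsuc i) a a≢b
liftEdge (matchE i)      = matchE (fsuc i)

liftPath : ∀ {nΣ n} {w : Vec (Fin nΣ) n} {a ωi ωd ωr u v x c} →
  Path (DEdge w ωi ωd ωr) u v x c → Path (DEdge (a ∷ w) ωi ωd ωr) (fsuc u) (fsuc v) x c
liftPath []      = []
liftPath (e ∷ p) = liftEdge e ∷ liftPath p

matchingPath : ∀ {nΣ n} (w : Vec (Fin nΣ) n) ωi ωd ωr → Path (DEdge w ωi ωd ωr) zero (fromℕ n) (toList w) 0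
matchingPath []      ωi ωd ωr = []
matchingPath (a ∷ w) ωi ωd ωr = matchE zero ∷ liftPath (matchingPath w ωi ωd ωr)

_≼_ : (ℕ → Set) → (ℕ → Set) → Set
Q ≼ R = ∀ c → Q c → ∃[ c' ] (R c' × c' ≤ c)

IsMin-transfer : ∀ {Q R k} → Q ≼ R → R ≼ Q → IsMin Q k → IsMin R k
IsMin-transfer {R = R} {k} Q≼R R≼Q (Qk , k-min) with Q≼R k Qk
... | c , Rc , c≤k with R≼Q c Rc
... | c' , Qc' , c'≤c = subst R (≤-antisym c≤k (≤-trans (k-min c' Qc') c'≤c)) Rc , R-bound
  where
    R-bound : ∀ m → R m → k ≤ m
    R-bound m Rm with R≼Q m Rm
    ... | m' , Qm' , m'≤m = ≤-trans (k-min m' Qm') m'≤m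

IsMin-⇔ : ∀ {Q R k} → Q ≼ R → R ≼ Q → IsMin Q k ⇔ IsMin R k
IsMin-⇔ Q≼R R≼Q = mk⇔ (IsMin-transfer Q≼R R≼Q) (IsMin-transfer R≼Q Q≼R)

lemma5 : ∀ {nN nΣ n} (G : CFG nN nΣ) (w : Vec (Fin nΣ) n) (ωins ωdel ωrepl : ℕ) (k : ℕ) →
    IsMin (EditCost G w ωins ωdel ωrepl) k ⇔
    IsMin (SPath G (DEdge w ωins ωdel ωrepl) zero (fromℕ n)) k
lemma5 {n = n} G w ωi ωd ωr k = IsMin-⇔ edits≼paths paths≼edits
  where
    open EditGraph w ωi ωd ωr

    edits≼paths : EditCost G w ωi ωd ωr ≼ SPath G D zero (fromℕ n)
    edits≼paths c (u , s , u∈L) with editSeq-replaceable s (matchingPath w ωi ωd ωr)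
    ... | c' , p , c'≤c = c' , (u , p , u∈L) , c'≤c

    paths≼edits : SPath G D zero (fromℕ n) ≼ EditCost G w ωi ωd ωr
    paths≼edits c (x , p , x∈L) = c , (x , w↝x , x∈L) , ≤-refl
      where
        x++[]≡x : x ++ unread (fromℕ n) ≡ x
        x++[]≡x = trans (cong (x ++_) (drop-fromℕ w)) (++-identityʳ x)

        w↝x : EditSeq ωi ωd ωr (toList w) x c
        w↝x = subst (λ y → EditSeq ωi ωd ωr (toList w) y c) x++[]≡x (path-editSeq p)
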